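{- Let $k$ be an odd positive integer and let $G$ be a $k$-tree. Then $T(G)=\frac{k+1}{2}$.
   Context: All graphs are finite and simple. A $k$-tree is constructed inductively by starting with $K_{k+1}$ and at each step adding a new vertex adjacent to exactly the $k$ vertices of some existing $k$-clique. $T(G)$, the tree cover number, is the minimum number of vertex-disjoint induced trees of $G$ whose union covers $V(G)$. -}

module Defs where

open import Level using (0ℓ)
open import Data.Nat using (ℕ; zero; suc; _≤_)
open import Data.Fin using (Fin; zero; suc)
open import Data.List using (List; []; _∷_; length)
open import Data.List.Membership.Propositional using (_∈_)
open import Data.List.Relation.Unary.All using (All)
open import Data.List.Relation.Unary.Unique.Propositional using (Unique)
open import Data.Product using (Σ; _×_; _,_; ∃)
open import Data.Empty using (⊥)
open import Relation.Nullary using (¬_)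
open import Relation.Binary.PropositionalEquality using (_≡_; _≢_)
open import Function.Bundles using (_↔_; Inverse)
import Data.List
import Data.Maybe

record Graph : Set₁ where
  field
    n      : ℕ
    Adj    : Fin n → Fin n → Set
    sym    : ∀ {x y} → Adj x y → Adj y x
    irrefl : ∀ {x} → ¬ Adj x x
open Graph public

record _≅_ (G H : Graph) : Set where
  field
    bij  : Fin (n G) ↔ Fin (n H)
    pres : ∀ x y → (Adj G x y → Adj H (Inverse.to bij x) (Inverse.to bij y))
                 × (Adj H (Inverse.to bij x) (Inverse.to bij y) → Adj G x y)

complete : ℕ → Graph
complete m = record
  { n = m ; Adj = λ x y → x ≢ y
  ; sym = λ p q → p (Relation.Binary.PropositionalEquality.sym q)
  ; irrefl = λ p → p Relation.Binary.PropositionalEquality.refl }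
  where import Relation.Binary.PropositionalEquality

record Clique (k : ℕ) (G : Graph) : Set where
  field
    verts  : List (Fin (n G))
    size   : length verts ≡ k
    unique : Unique verts
    adj    : ∀ {x y} → x ∈ verts → y ∈ verts → x ≢ y → Adj G x y
open Clique public

-- Adding a new vertex (labelled zero; old vertex i becomes suc i) adjacent exactly
-- to the vertices of the clique C.
addVertex : ∀ {k} (G : Graph) → Clique k G → Graph
addVertex G C = record { n = suc (n G) ; Adj = A ; sym = λ {x} {y} → s {x} {y} ; irrefl = λ {x} → ir {x} }
  where
  A : Fin (suc (n G)) → Fin (suc (n G)) → Set
  A zero    zero    = ⊥
  A zero    (suc y) = y ∈ verts C
  A (suc x) zero    = x ∈ verts C
  A (suc x) (suc y) = Adj G x y
  s : ∀ {x y} → A x y → A y x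
  s {zero}  {suc y} p = p
  s {suc x} {zero}  p = p
  s {suc x} {suc y} p = sym G p
  ir : ∀ {x} → ¬ A x x
  ir {suc x} p = irrefl G p

-- Graphs built by the inductive k-tree construction (with canonical labelling).
data BuiltKTree (k : ℕ) : Graph → Set₁ where
  base : BuiltKTree k (complete (suc k))
  step : ∀ {G} → BuiltKTree k G → (C : Clique k G) → BuiltKTree k (addVertex G C)

IsKTree : ℕ → Graph → Set₁
IsKTree k G = Σ Graph λ H → BuiltKTree k H × (G ≅ H)

module _ (G : Graph) (S : Fin (n G) → Set) where

  data WalkIn : Fin (n G) → Fin (n G) → Set where
    here : ∀ {x} → S x → WalkIn x x
    cons : ∀ {x y z} → S x → Adj G x y → WalkIn y z → WalkIn x z

  data Path : List (Fin (n G)) → Set where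
    one  : ∀ {x} → Path (x ∷ [])
    more : ∀ {x y vs} → Adj G x y → Path (y ∷ vs) → Path (x ∷ y ∷ vs)

  record CycleIn : Set where
    field
      first  : Fin (n G)
      rest   : List (Fin (n G))
      long   : 2 ≤ length rest
      inS    : All S (first ∷ rest)
      uniq   : Unique (first ∷ rest)
      path   : Path (first ∷ rest)
      close  : ∃ λ last → Data.List.last (first ∷ rest) ≡ Data.Maybe.just last × Adj G last first

  record InducesTree : Set where
    field
      nonempty  : ∃ S
      connected : ∀ x y → S x → S y → WalkIn x y
      acyclic   : ¬ CycleIn

TreeCover : Graph → ℕ → Set
TreeCover G m = Σ (Fin (n G) → Fin m) λ c → ∀ j → InducesTree G (λ x → c x ≡ j)

TreeCoverNumberIs : Graph → ℕ → Set
TreeCoverNumberIs G t = TreeCover G t × (∀ m → TreeCover G m → t ≤ m)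

-- Write k = 2q + 1.  Every class of a tree cover induces an acyclic graph, so it
-- contains at most two vertices of any clique: three would form a triangle.
--
-- Lower bound.  A k-tree contains a (k + 1)-clique; summing the sizes of its
-- intersections with the m classes gives k + 1 ≤ 2m, i.e. q + 1 ≤ m.
--
-- Upper bound, by induction along the construction of the k-tree.  The starting
-- clique K_{2q+2} is covered by q + 1 edges.  When a vertex is attached to a
-- k-clique C, the classes meet C in 0, 1 or 2 vertices and these numbers add up
-- to the odd number k, so some class meets C in exactly one vertex u.  The new
-- vertex joins that class: it is connected to the class through u, and it lies
-- on no cycle of the class because it has only one neighbour (u) there.
--
-- Finally, tree covers are transported along graph isomorphisms, which takes
-- the result from the canonically labelled k-trees to arbitrary ones.
module Submission where

open import Defs
open import Data.Nat using (ℕ; zero; suc; _+_; _*_; _%_; _/_; _≤_; z≤n; s≤s)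
import Data.Nat.Properties as ℕP
import Data.Nat.DivMod as DivMod
open import Data.Fin using (Fin; zero; suc; quotient; remainder; combine)
import Data.Fin.Properties as FinP
open import Data.List using (List; []; _∷_; _++_; length; map; filter; last; allFin)
import Data.List.Properties as ListP
open import Data.List.Membership.Propositional using (_∈_)
import Data.List.Membership.Propositional.Properties as ∈P
open import Data.List.Relation.Unary.Any using (here; there)
open import Data.List.Relation.Unary.All as All using (All; []; _∷_)
import Data.List.Relation.Unary.All.Properties as AllP
open import Data.List.Relation.Unary.AllPairs using ([]; _∷_)
open import Data.List.Relation.Unary.Unique.Propositional using (Unique)
import Data.List.Relation.Unary.Unique.Propositional.Properties as UniqueP
open import Data.Maybe using (just)
import Data.Maybe as Maybe
open import Data.Product using (Σ; _×_; _,_; ∃; proj₁; proj₂)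
open import Data.Sum using (_⊎_; inj₁; inj₂)
open import Data.Empty using (⊥; ⊥-elim)
open import Data.Bool using (true; false; if_then_else_)
open import Relation.Nullary using (¬_; yes; no; does)
open import Relation.Unary using (Decidable)
open import Relation.Binary.PropositionalEquality
  using (_≡_; _≢_; refl; cong; cong₂; subst; subst₂; module ≡-Reasoning)
  renaming (sym to ≡-sym; trans to ≡-trans)
open import Function.Bundles using (Inverse)
open import Function.Properties.Inverse using (↔-sym)
open import Algebra.Properties.CommutativeMonoid.Sum ℕP.+-0-commutativeMonoid
  using (sum; sum-cong-≗; ∑-distrib-+; sum-replicate-zero)

Vertex : Graph → Set
Vertex G = Fin (n G)

Acyclic : (G : Graph) → (Vertex G → Set) → Set
Acyclic G S = ¬ CycleIn G S

last-∈ : ∀ {A : Set} (xs : List A) {l : A} → last xs ≡ just l → l ∈ xs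
last-∈ (x ∷ []) refl = here refl
last-∈ (x ∷ y ∷ xs) eq = there (last-∈ (y ∷ xs) eq)

last-snoc : ∀ {A : Set} (xs : List A) (a : A) → last (xs ++ a ∷ []) ≡ just a
last-snoc [] a = refl
last-snoc (x ∷ []) a = refl
last-snoc (x ∷ y ∷ xs) a = last-snoc (y ∷ xs) a

module _ {G : Graph} {S : Vertex G → Set} where

  walkStart : ∀ {x y} → WalkIn G S x y → S x
  walkStart (here Sx) = Sx
  walkStart (cons Sx _ _) = Sx

  snocWalk : ∀ {x y z} → WalkIn G S x y → Adj G y z → S z → WalkIn G S x z
  snocWalk (here Sx) y~z Sz = cons Sx y~z (here Sz)
  snocWalk (cons Sx x~w w⋯y) y~z Sz = cons Sx x~w (snocWalk w⋯y y~z Sz)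

  snocPath : ∀ xs {l a} → Path G S xs → last xs ≡ just l → Adj G l a → Path G S (xs ++ a ∷ [])
  snocPath (x ∷ []) one refl x~a = more x~a one
  snocPath (x ∷ y ∷ xs) (more x~y p) eq l~a = more x~y (snocPath (y ∷ xs) p eq l~a)

  reindexPath : ∀ {T : Vertex G → Set} {xs} → Path G S xs → Path G T xs
  reindexPath one = one
  reindexPath (more x~y p) = more x~y (reindexPath p)

module Cycles {G : Graph} {S : Vertex G → Set} where
  open CycleIn

  vertices : CycleIn G S → List (Vertex G)
  vertices cy = first cy ∷ rest cy

  rotate : (cy : CycleIn G S) → Σ (CycleIn G S) λ cy′ → vertices cy′ ≡ rest cy ++ first cy ∷ []
  rotate record { rest = [] ; long = () }
  rotate record { first = a ; rest = b ∷ bs ; long = s≤s 1≤|bs| ; inS = Sa ∷ Sbbs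
                ; uniq = a∉bbs ∷ bbs! ; path = more a~b bbs-path ; close = l , last≡l , l~a }
    = record
        { first = b
        ; rest = bs ++ a ∷ []
        ; long = subst (2 ≤_) (≡-sym (ListP.length-++ bs)) (ℕP.+-monoˡ-≤ 1 1≤|bs|)
        ; inS = AllP.++⁺ Sbbs (Sa ∷ [])
        ; uniq = UniqueP.++⁺ bbs! ([] ∷ []) λ { (a∈bbs , here refl) → All.lookup a∉bbs a∈bbs refl }
        ; path = snocPath (b ∷ bs) bbs-path last≡l l~a
        ; close = a , last-snoc (b ∷ bs) a , a~b
        }
    , refl

  rotateTo : ∀ ys {v} zs (cy : CycleIn G S) → vertices cy ≡ ys ++ v ∷ zs →
             Σ (CycleIn G S) λ cy′ → first cy′ ≡ v
  rotateTo [] zs cy eq = cy , ListP.∷-injectiveˡ eq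
  rotateTo (y ∷ ys) {v} zs cy eq with rotate cy
  ... | cy′ , cy′≡ = rotateTo ys (zs ++ y ∷ []) cy′ (begin
    vertices cy′                ≡⟨ cy′≡ ⟩
    rest cy ++ first cy ∷ []    ≡⟨ cong₂ (λ r f → r ++ f ∷ []) (ListP.∷-injectiveʳ eq) (ListP.∷-injectiveˡ eq) ⟩
    (ys ++ v ∷ zs) ++ y ∷ []    ≡⟨ ListP.++-assoc ys (v ∷ zs) (y ∷ []) ⟩
    ys ++ v ∷ zs ++ y ∷ []      ∎)
    where open ≡-Reasoning

  record TwoNeighbours (v : Vertex G) : Set where
    constructor twoNeighbours
    field
      a b : Vertex G
      a≢b : a ≢ b
      v~a : Adj G v a
      v~b : Adj G v b
      Sa  : S a
      Sb  : S b

  firstHasTwoNeighbours : (cy : CycleIn G S) → TwoNeighbours (first cy)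
  firstHasTwoNeighbours record { rest = [] ; long = () }
  firstHasTwoNeighbours record { rest = _ ∷ [] ; long = s≤s () }
  firstHasTwoNeighbours record { rest = b ∷ c ∷ cs ; inS = _ ∷ Sb ∷ Sccs ; uniq = _ ∷ (b∉ccs ∷ _)
                               ; path = more a~b _ ; close = l , last≡l , l~a }
    = twoNeighbours b l (All.lookup b∉ccs l∈ccs) a~b (sym G l~a) Sb (All.lookup Sccs l∈ccs)
    where
    l∈ccs : l ∈ c ∷ cs
    l∈ccs = last-∈ (c ∷ cs) last≡l

  onCycleHasTwoNeighbours : (cy : CycleIn G S) → ∀ {v} → v ∈ vertices cy → TwoNeighbours v
  onCycleHasTwoNeighbours cy v∈cy with ∈P.∈-∃++ v∈cy
  ... | ys , zs , eq with rotateTo ys zs cy eq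
  ...   | cy′ , refl = firstHasTwoNeighbours cy′

  restrictCycle : (P : Vertex G → Set) (cy : CycleIn G S) → All P (vertices cy) →
                  CycleIn G (λ x → S x × P x)
  restrictCycle P cy Pcy = record
    { first = first cy ; rest = rest cy ; long = long cy
    ; inS = All.zipWith (λ x → x) (inS cy , Pcy) ; uniq = uniq cy
    ; path = reindexPath (path cy) ; close = close cy }

  triangle : ∀ {a b d} → S a → S b → S d → a ≢ b → a ≢ d → b ≢ d →
             Adj G a b → Adj G b d → Adj G d a → CycleIn G S
  triangle {a} {b} {d} Sa Sb Sd a≢b a≢d b≢d a~b b~d d~a = record
    { first = a ; rest = b ∷ d ∷ [] ; long = s≤s (s≤s z≤n)
    ; inS = Sa ∷ Sb ∷ Sd ∷ [] ; uniq = (a≢b ∷ a≢d ∷ []) ∷ (b≢d ∷ []) ∷ [] ∷ []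
    ; path = more a~b (more b~d one) ; close = d , refl , d~a }

record InducedEmbedding (G H : Graph) (S : Vertex G → Set) (T : Vertex H → Set) : Set where
  field
    f         : Vertex G → Vertex H
    preserves : ∀ {x} → S x → T (f x)
    injective : ∀ {x y} → S x → S y → f x ≡ f y → x ≡ y
    adjacent  : ∀ {x y} → S x → S y → Adj G x y → Adj H (f x) (f y)

module _ {G H : Graph} {S : Vertex G → Set} {T : Vertex H → Set} (e : InducedEmbedding G H S T) where
  open InducedEmbedding e

  embedWalk : ∀ {x y} → WalkIn G S x y → WalkIn H T (f x) (f y)
  embedWalk (here Sx) = here (preserves Sx)
  embedWalk (cons Sx x~y w) = cons (preserves Sx) (adjacent Sx (walkStart w) x~y) (embedWalk w)

  private
    embedPath : ∀ {xs} → All S xs → Path G S xs → Path H T (map f xs)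
    embedPath (_ ∷ []) one = one
    embedPath (Sx ∷ Sy ∷ Sxs) (more x~y p) = more (adjacent Sx Sy x~y) (embedPath (Sy ∷ Sxs) p)

    embedUnique : ∀ {xs} → All S xs → Unique xs → Unique (map f xs)
    embedUnique [] [] = []
    embedUnique (Sx ∷ Sxs) (x∉xs ∷ xs!) =
      AllP.map⁺ (All.zipWith (λ (Sy , x≢y) fx≡fy → x≢y (injective Sx Sy fx≡fy)) (Sxs , x∉xs))
      ∷ embedUnique Sxs xs!

  embedCycle : CycleIn G S → CycleIn H T
  embedCycle cy = record
    { first = f first
    ; rest = map f rest
    ; long = subst (2 ≤_) (≡-sym (ListP.length-map f rest)) long
    ; inS = AllP.map⁺ (All.map preserves inS)
    ; uniq = embedUnique inS uniq
    ; path = embedPath inS path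
    ; close = f l , ≡-trans (ListP.last-map f (first ∷ rest)) (cong (Maybe.map f) last≡l)
            , adjacent (All.lookup inS (last-∈ (first ∷ rest) last≡l)) (All.lookup inS (here refl)) l~first
    }
    where
    open CycleIn cy
    l = proj₁ close
    last≡l = proj₁ (proj₂ close)
    l~first = proj₂ (proj₂ close)

module _ {G H : Graph} (iso : G ≅ H) where
  open _≅_ iso
  private
    to = Inverse.to bij
    from = Inverse.from bij

    to-from : ∀ y → to (from y) ≡ y
    to-from y = Inverse.inverseˡ bij refl

    from-to : ∀ x → from (to x) ≡ x
    from-to x = Inverse.inverseʳ bij refl

    from-adjacent : ∀ {a b} → Adj H a b → Adj G (from a) (from b)
    from-adjacent {a} {b} a~b =
      proj₂ (pres (from a) (from b)) (subst₂ (Adj H) (≡-sym (to-from a)) (≡-sym (to-from b)) a~b)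

  ≅-sym : H ≅ G
  ≅-sym = record
    { bij = ↔-sym bij
    ; pres = λ a b → from-adjacent
                   , λ fa~fb → subst₂ (Adj H) (to-from a) (to-from b) (proj₁ (pres (from a) (from b)) fa~fb) }

  pullbackCover : ∀ {m} → TreeCover H m → TreeCover G m
  pullbackCover (c , trees) = (λ x → c (to x)) , tree
    where
    tree : ∀ i → InducesTree G (λ x → c (to x) ≡ i)
    tree i = record
      { nonempty = from y , Sy′
      ; connected = λ x x′ p p′ → subst₂ (WalkIn G _) (from-to x) (from-to x′)
          (embedWalk fromEmbedding (InducesTree.connected (trees i) (to x) (to x′) p p′))
      ; acyclic = λ cy → InducesTree.acyclic (trees i) (embedCycle toEmbedding cy) }
      where
      y = proj₁ (InducesTree.nonempty (trees i))
      Sy′ = subst (λ z → c z ≡ i) (≡-sym (to-from y)) (proj₂ (InducesTree.nonempty (trees i)))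

      toEmbedding : InducedEmbedding G H (λ x → c (to x) ≡ i) (λ y → c y ≡ i)
      toEmbedding = record
        { f = to ; preserves = λ p → p
        ; injective = λ {x} {x′} _ _ eq → ≡-trans (≡-sym (from-to x)) (≡-trans (cong from eq) (from-to x′))
        ; adjacent = λ {x} {x′} _ _ → proj₁ (pres x x′) }

      fromEmbedding : InducedEmbedding H G (λ y → c y ≡ i) (λ x → c (to x) ≡ i)
      fromEmbedding = record
        { f = from ; preserves = λ {y} → subst (λ z → c z ≡ i) (≡-sym (to-from y))
        ; injective = λ {y} {y′} _ _ eq → ≡-trans (≡-sym (to-from y)) (≡-trans (cong to eq) (to-from y′))
        ; adjacent = λ _ _ → from-adjacent }

coverNumber-≅ : ∀ {G H t} → G ≅ H → TreeCoverNumberIs H t → TreeCoverNumberIs G t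
coverNumber-≅ iso (cover , minimal) =
  pullbackCover iso cover , λ m cover′ → minimal m (pullbackCover (≅-sym iso) cover′)

mapClique : ∀ {r} {G H : Graph} (f : Vertex G → Vertex H) → (∀ {x y} → f x ≡ f y → x ≡ y) →
            (∀ {x y} → Adj G x y → Adj H (f x) (f y)) → Clique r G → Clique r H
mapClique {H = H} f f-inj f-adj K = record
  { verts = map f (verts K)
  ; size = ≡-trans (ListP.length-map f (verts K)) (size K)
  ; unique = UniqueP.map⁺ f-inj (unique K)
  ; adj = adjacent }
  where
  adjacent : ∀ {x y} → x ∈ map f (verts K) → y ∈ map f (verts K) → x ≢ y → Adj H x y
  adjacent x∈ y∈ x≢y with ∈P.∈-map⁻ f x∈ | ∈P.∈-map⁻ f y∈
  ... | x′ , x′∈K , refl | y′ , y′∈K , refl = f-adj (adj K x′∈K y′∈K (λ x′≡y′ → x≢y (cong f x′≡y′)))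

builtClique : ∀ {k H} → BuiltKTree k H → Clique (suc k) H
builtClique {k} base = record
  { verts = allFin (suc k) ; size = ListP.length-tabulate (λ x → x)
  ; unique = UniqueP.allFin⁺ (suc k) ; adj = λ _ _ x≢y → x≢y }
builtClique (step built C) = mapClique suc FinP.suc-injective (λ x~y → x~y) (builtClique built)

-- A list of distinct, pairwise adjacent vertices of an acyclic set has at most
-- two elements, as three of them would form a triangle.
atMostTwo : ∀ {G : Graph} {S : Vertex G → Set} → Acyclic G S → ∀ xs → Unique xs → All S xs →
            (∀ {x y} → x ∈ xs → y ∈ xs → x ≢ y → Adj G x y) → length xs ≤ 2
atMostTwo _ [] _ _ _ = z≤n
atMostTwo _ (_ ∷ []) _ _ _ = s≤s z≤n
atMostTwo _ (_ ∷ _ ∷ []) _ _ _ = s≤s (s≤s z≤n)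
atMostTwo acyclic (a ∷ b ∷ d ∷ _) ((a≢b ∷ a≢d ∷ _) ∷ (b≢d ∷ _) ∷ _) (Sa ∷ Sb ∷ Sd ∷ _) adjacent =
  ⊥-elim (acyclic (Cycles.triangle Sa Sb Sd a≢b a≢d b≢d
    (adjacent a∈ b∈ a≢b) (adjacent b∈ d∈ b≢d) (adjacent d∈ a∈ (λ d≡a → a≢d (≡-sym d≡a)))))
  where
  a∈ = here refl
  b∈ = there (here refl)
  d∈ = there (there (here refl))

cliqueMeetsAcyclic : ∀ {r G} {S : Vertex G → Set} (S? : Decidable S) → Acyclic G S →
                     (K : Clique r G) → length (filter S? (verts K)) ≤ 2
cliqueMeetsAcyclic {S = S} S? acyclic K = atMostTwo acyclic (filter S? (verts K))
  (UniqueP.filter⁺ S? (unique K))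
  (All.tabulate (λ x∈ → proj₂ (filtered x∈)))
  (λ x∈ y∈ → adj K (proj₁ (filtered x∈)) (proj₁ (filtered y∈)))
  where
  filtered : ∀ {x} → x ∈ filter S? (verts K) → x ∈ verts K × S x
  filtered = ∈P.∈-filter⁻ S?

δ : ∀ {m} → Fin m → Fin m → ℕ
δ i j = if does (i FinP.≟ j) then 1 else 0

sum-δ : ∀ {m} (i : Fin m) → sum (δ i) ≡ 1
sum-δ {suc m} zero = cong suc (sum-replicate-zero m)
sum-δ (suc i) = sum-δ i

sum-≤ : ∀ {m b} (f : Fin m → ℕ) → (∀ j → f j ≤ b) → sum f ≤ m * b
sum-≤ {zero} f _ = z≤n
sum-≤ {suc m} f f≤b = ℕP.+-mono-≤ (f≤b zero) (sum-≤ (λ j → f (suc j)) (λ j → f≤b (suc j)))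

module ClassSizes {A : Set} {m : ℕ} (c : A → Fin m) where

  inClass? : ∀ j → Decidable (λ x → c x ≡ j)
  inClass? j x = c x FinP.≟ j

  members : Fin m → List A → List A
  members j = filter (inClass? j)

  size-cons : ∀ j x xs → length (members j (x ∷ xs)) ≡ δ (c x) j + length (members j xs)
  size-cons j x xs with does (c x FinP.≟ j)
  ... | true = refl
  ... | false = refl

  -- Every element of xs lies in exactly one class.
  sum-sizes : ∀ xs → sum (λ j → length (members j xs)) ≡ length xs
  sum-sizes [] = sum-replicate-zero m
  sum-sizes (x ∷ xs) = begin
    sum (λ j → length (members j (x ∷ xs)))              ≡⟨ sum-cong-≗ (λ j → size-cons j x xs) ⟩
    sum (λ j → δ (c x) j + length (members j xs))        ≡⟨ ∑-distrib-+ (δ (c x)) _ ⟩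
    sum (δ (c x)) + sum (λ j → length (members j xs))    ≡⟨ cong₂ _+_ (sum-δ (c x)) (sum-sizes xs) ⟩
    suc (length xs)                                      ∎
    where open ≡-Reasoning

  singleMember : ∀ j xs → length (members j xs) ≡ 1 →
                 Σ A λ u → u ∈ xs × c u ≡ j × (∀ {y} → y ∈ xs → c y ≡ j → y ≡ u)
  singleMember j xs size≡1 with members j xs in eq | size≡1
  ... | u ∷ [] | _ = u , proj₁ u∈ , proj₂ u∈ , only-u
    where
    u∈ : u ∈ xs × c u ≡ j
    u∈ = ∈P.∈-filter⁻ (inClass? j) (subst (u ∈_) (≡-sym eq) (here refl))
    only-u : ∀ {y} → y ∈ xs → c y ≡ j → y ≡ u
    only-u y∈ cy≡j with subst (_ ∈_) eq (∈P.∈-filter⁺ (inClass? j) y∈ cy≡j)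
    ... | here y≡u = y≡u

-- Lower bound: each of the m trees contains at most two vertices of an
-- r-clique, so r ≤ 2m.
cliqueBound : ∀ {r m G} → Clique r G → TreeCover G m → r ≤ m * 2
cliqueBound {r} {m} K (c , trees) = begin
  r                                        ≡⟨ ≡-sym (size K) ⟩
  length (verts K)                         ≡⟨ ≡-sym (sum-sizes (verts K)) ⟩
  sum (λ j → length (members j (verts K))) ≤⟨ sum-≤ _ (λ j → cliqueMeetsAcyclic (inClass? j)
                                                             (InducesTree.acyclic (trees j)) K) ⟩
  m * 2                                    ∎
  where
  open ClassSizes c
  open ℕP.≤-Reasoning

noThreeDistinct : (a b d : Fin 2) → a ≢ b → a ≢ d → b ≢ d → ⊥
noThreeDistinct zero zero _ a≢b _ _ = a≢b refl
noThreeDistinct (suc zero) (suc zero) _ a≢b _ _ = a≢b refl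
noThreeDistinct zero (suc zero) zero _ a≢d _ = a≢d refl
noThreeDistinct zero (suc zero) (suc zero) _ _ b≢d = b≢d refl
noThreeDistinct (suc zero) zero zero _ _ b≢d = b≢d refl
noThreeDistinct (suc zero) zero (suc zero) _ a≢d _ = a≢d refl

remainder-distinct : ∀ {m} {x y : Fin (m * 2)} → x ≢ y →
                     quotient {m} 2 x ≡ quotient {m} 2 y → remainder {m} 2 x ≢ remainder {m} 2 y
remainder-distinct {m} {x} {y} x≢y qx≡qy rx≡ry = x≢y (begin
  x                                              ≡⟨ ≡-sym (FinP.combine-remQuot {m} 2 x) ⟩
  combine (quotient {m} 2 x) (remainder {m} 2 x) ≡⟨ cong₂ combine qx≡qy rx≡ry ⟩
  combine (quotient {m} 2 y) (remainder {m} 2 y) ≡⟨ FinP.combine-remQuot {m} 2 y ⟩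
  y                                              ∎)
  where open ≡-Reasoning

complete-connected : ∀ {r} (S : Fin r → Set) x y → S x → S y → WalkIn (complete r) S x y
complete-connected S x y Sx Sy with x FinP.≟ y
... | yes refl = here Sx
... | no x≢y = cons Sx x≢y (here Sy)

-- Upper bound, base case: K_{2m} is covered by m edges, class j being the pair
-- of vertices with quotient j under division by 2.  A cycle in a class would
-- need three distinct vertices there, i.e. three distinct remainders.
pairCover : ∀ m → TreeCover (complete (m * 2)) m
pairCover m = quotient {m} 2 , λ j → record
  { nonempty = combine j zero , cong proj₁ (FinP.remQuot-combine j zero)
  ; connected = complete-connected _
  ; acyclic = pair-acyclic j }
  where
  pair-acyclic : ∀ j → Acyclic (complete (m * 2)) (λ x → quotient {m} 2 x ≡ j)
  pair-acyclic j record { rest = [] ; long = () }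
  pair-acyclic j record { rest = _ ∷ [] ; long = s≤s () }
  pair-acyclic j record { first = a ; rest = b ∷ d ∷ _ ; inS = qa ∷ qb ∷ qd ∷ _
                        ; uniq = (a≢b ∷ a≢d ∷ _) ∷ (b≢d ∷ _) ∷ _ } =
    noThreeDistinct (remainder {m} 2 a) (remainder {m} 2 b) (remainder {m} 2 d)
      (remainder-distinct {m} a≢b (≡-trans qa (≡-sym qb)))
      (remainder-distinct {m} a≢d (≡-trans qa (≡-sym qd)))
      (remainder-distinct {m} b≢d (≡-trans qb (≡-sym qd)))

module Extension {k m : ℕ} (H : Graph) (C : Clique k H) (c : Vertex H → Fin m)
  (trees : ∀ i → InducesTree H (λ x → c x ≡ i))
  (j : Fin m) (u : Vertex H) (u∈C : u ∈ verts C) (cu≡j : c u ≡ j)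
  (only-u : ∀ {y} → y ∈ verts C → c y ≡ j → y ≡ u) where

  open import Data.List.Membership.DecPropositional (FinP._≟_ {suc (n H)}) using (_∈?_)
  open Cycles

  G′ : Graph
  G′ = addVertex H C

  c′ : Vertex G′ → Fin m
  c′ zero = j
  c′ (suc x) = c x

  module _ (i : Fin m) where
    Class : Vertex H → Set
    Class x = c x ≡ i

    Class′ : Vertex G′ → Set
    Class′ x = c′ x ≡ i

    lift : InducedEmbedding H G′ Class Class′
    lift = record { f = suc ; preserves = λ p → p ; injective = λ _ _ → FinP.suc-injective
                  ; adjacent = λ _ _ x~y → x~y }

    Old : Vertex G′ → Set
    Old x = Class′ x × zero ≢ x

    forget : Vertex G′ → Vertex H
    forget zero = u
    forget (suc x) = x

    restrict : InducedEmbedding G′ H Old Class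
    restrict = record { f = forget ; preserves = preserves ; injective = injective ; adjacent = adjacent }
      where
      preserves : ∀ {x} → Old x → Class (forget x)
      preserves {zero} (_ , 0≢0) = ⊥-elim (0≢0 refl)
      preserves {suc x} (Sx , _) = Sx
      injective : ∀ {x y} → Old x → Old y → forget x ≡ forget y → x ≡ y
      injective {zero} (_ , 0≢0) _ _ = ⊥-elim (0≢0 refl)
      injective {suc x} {zero} _ (_ , 0≢0) _ = ⊥-elim (0≢0 refl)
      injective {suc x} {suc y} _ _ x≡y = cong suc x≡y
      adjacent : ∀ {x y} → Old x → Old y → Adj G′ x y → Adj H (forget x) (forget y)
      adjacent {zero} (_ , 0≢0) _ _ = ⊥-elim (0≢0 refl)
      adjacent {suc x} {zero} _ (_ , 0≢0) _ = ⊥-elim (0≢0 refl)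
      adjacent {suc x} {suc y} _ _ x~y = x~y

    -- Walks of H lift to G′, and the new vertex is reached through u.
    connected′ : ∀ x y → Class′ x → Class′ y → WalkIn G′ Class′ x y
    connected′ zero zero j≡i _ = here j≡i
    connected′ zero (suc y) j≡i Sy =
      cons j≡i u∈C (embedWalk lift (InducesTree.connected (trees i) u y (≡-trans cu≡j j≡i) Sy))
    connected′ (suc x) zero Sx j≡i =
      snocWalk (embedWalk lift (InducesTree.connected (trees i) x u Sx (≡-trans cu≡j j≡i))) u∈C j≡i
    connected′ (suc x) (suc y) Sx Sy = embedWalk lift (InducesTree.connected (trees i) x y Sx Sy)

    onlyNeighbour : j ≡ i → ∀ {a} → Adj G′ zero a → Class′ a → a ≡ suc u
    onlyNeighbour j≡i {suc a} a∈C ca≡i = cong suc (only-u a∈C (≡-trans ca≡i (≡-sym j≡i)))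

    -- A cycle through the new vertex would give it two distinct neighbours in
    -- its class; a cycle avoiding it is a cycle of H.
    acyclic′ : Acyclic G′ Class′
    acyclic′ cy with zero ∈? vertices cy
    ... | yes 0∈cy = a≢b (≡-trans (onlyNeighbour j≡i v~a Sa) (≡-sym (onlyNeighbour j≡i v~b Sb)))
      where
      open TwoNeighbours (onCycleHasTwoNeighbours cy 0∈cy)
      j≡i = All.lookup (CycleIn.inS cy) 0∈cy
    ... | no 0∉cy = InducesTree.acyclic (trees i)
      (embedCycle restrict (restrictCycle (zero ≢_) cy (AllP.¬Any⇒All¬ (vertices cy) 0∉cy)))

    tree : InducesTree G′ Class′
    tree = record
      { nonempty = suc (proj₁ (InducesTree.nonempty (trees i))) , proj₂ (InducesTree.nonempty (trees i))
      ; connected = connected′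
      ; acyclic = acyclic′ }

  cover : TreeCover G′ m
  cover = c′ , tree

peelOddSum : ∀ a {s} q → a ≤ 2 → a + s ≡ suc (q * 2) → a ≡ 1 ⊎ ∃ λ q′ → s ≡ suc (q′ * 2)
peelOddSum 0 q _ a+s≡ = inj₂ (q , a+s≡)
peelOddSum 1 _ _ _ = inj₁ refl
peelOddSum 2 zero _ ()
peelOddSum 2 (suc q) _ a+s≡ = inj₂ (q , ℕP.suc-injective (ℕP.suc-injective a+s≡))
peelOddSum (suc (suc (suc _))) _ (s≤s (s≤s ())) _

oddSumHasOne : ∀ {m} q (f : Fin m → ℕ) → (∀ j → f j ≤ 2) → sum f ≡ suc (q * 2) →
               ∃ λ j → f j ≡ 1
oddSumHasOne {zero} q f _ ()
oddSumHasOne {suc m} q f f≤2 sum≡ with peelOddSum (f zero) q (f≤2 zero) sum≡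
... | inj₁ f0≡1 = zero , f0≡1
... | inj₂ (q′ , rest≡) with oddSumHasOne q′ (λ j → f (suc j)) (λ j → f≤2 (suc j)) rest≡
...   | j , fj≡1 = suc j , fj≡1

extendCover : ∀ {m H} q (C : Clique (suc (q * 2)) H) → TreeCover H m → TreeCover (addVertex H C) m
extendCover q C (c , trees) with oddSumHasOne q (λ j → length (ClassSizes.members c j (verts C)))
    (λ j → cliqueMeetsAcyclic (ClassSizes.inClass? c j) (InducesTree.acyclic (trees j)) C)
    (≡-trans (ClassSizes.sum-sizes c (verts C)) (size C))
... | j , meetsOnce with ClassSizes.singleMember c j (verts C) meetsOnce
...   | u , u∈C , cu≡j , only-u = Extension.cover _ C c trees j u u∈C cu≡j only-u

upperBound : ∀ q {H} → BuiltKTree (suc (q * 2)) H → TreeCover H (suc q)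
upperBound q base = pairCover (suc q)
upperBound q (step built C) = extendCover q C (upperBound q built)

builtCoverNumber : ∀ q {H} → BuiltKTree (suc (q * 2)) H → TreeCoverNumberIs H (suc q)
builtCoverNumber q built = upperBound q built , λ m cover →
  ℕP.*-cancelʳ-≤ (suc q) m 2 (cliqueBound (builtClique built) cover)

theorem9p2 : (k : ℕ) → k % 2 ≡ 1 → (G : Graph) → IsKTree k G →
    TreeCoverNumberIs G (suc k / 2)
theorem9p2 k k-odd G (H , built , G≅H) =
  subst (TreeCoverNumberIs G) (≡-sym half≡)
    (coverNumber-≅ G≅H (builtCoverNumber q (subst (λ k′ → BuiltKTree k′ H) k≡ built)))
  where
  q = k / 2
  k≡ : k ≡ suc (q * 2)
  k≡ = ≡-trans (DivMod.m≡m%n+[m/n]*n k 2) (cong (_+ q * 2) k-odd)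
  half≡ : suc k / 2 ≡ suc q
  half≡ = ≡-trans (cong (λ k′ → suc k′ / 2) k≡) (DivMod.m*n/n≡m (suc q) 2)
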